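{- For all integers $n \ge 1$ and $d \ge 2$, there exist sets $A_1, \dots, A_n \subseteq \mathbb{Z}/d^n\mathbb{Z}$ with $|A_i| = d^{n-1}$ for each $i$ such that $\bigcap_{i=1}^n (A_i - A_i) = \{0\}$.
   Context: For $A \subseteq \mathbb{Z}/m\mathbb{Z}$, $A - A = \{a - a' : a, a' \in A\}$. A collection $\{A_1,\dots,A_n\}$ of subsets of $\mathbb{Z}/m\mathbb{Z}$ with $\bigcap_{i}(A_i - A_i) = \{0\}$ is called difference-disjoint. -}

module Defs where

open import Data.Nat using (ℕ; zero; suc; _+_; _∸_; NonZero; _%_)
open import Data.Nat.DivMod using (_mod_)
open import Data.Fin using (Fin; toℕ)
open import Data.Fin.Subset using (Subset; _∈_)
open import Data.Product using (Σ; _×_; _,_)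
open import Relation.Binary.PropositionalEquality using (_≡_)

-- ℤ/mℤ is modelled as Fin m (residues 0..m-1), for m ≠ 0.
-- Subtraction in ℤ/mℤ:  a - b = (a + m - b) mod m.
_⊖_ : ∀ {m} .{{_ : NonZero m}} → Fin m → Fin m → Fin m
_⊖_ {m} a b = ((toℕ a + m) ∸ toℕ b) mod m

_∈Diff_ : ∀ {m} .{{_ : NonZero m}} → Fin m → Subset m → Set
_∈Diff_ {m} x A = Σ (Fin m) λ a → Σ (Fin m) λ a' → (a ∈ A) × (a' ∈ A) × (x ≡ a ⊖ a')

zeroₘ : ∀ {m} .{{_ : NonZero m}} → Fin m
zeroₘ {m} = 0 mod m

DifferenceDisjoint : ∀ {m n} .{{_ : NonZero m}} → (Fin n → Subset m) → Set
DifferenceDisjoint {m} {n} A =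
  (x : Fin m) → ((∀ (i : Fin n) → x ∈Diff (A i)) → x ≡ zeroₘ)
              × (x ≡ zeroₘ → ∀ (i : Fin n) → x ∈Diff (A i))

{-# OPTIONS --safe #-}
-- Take A i to be the residues mod d ^ n whose i-th base-d digit vanishes,
-- i.e. x % d ^ (i + 1) < d ^ i; exactly d ^ (n - 1) residues qualify.
-- Suppose x = a ⊖ a' with a, a' ∈ A i and d ^ i ∣ x. Then s = x % d ^ (i + 1)
-- is a multiple of d ^ i, and s + a' % d ^ (i + 1) ≡ a % d ^ (i + 1) holds
-- without carry because a' % d ^ (i + 1) < d ^ i; as the right side is below
-- d ^ i, s = 0. By induction on i, an x lying in every A i ⊖ A i is divisible
-- by d ^ n, hence x = 0.
module Submission where

open import Function using (_∘_; Equivalence)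
open import Data.Bool using (Bool; true; false; T)
open import Data.Bool.Properties using (T-≡)
open import Data.Nat
open import Data.Nat.Properties
open import Data.Nat.DivMod
open import Data.Nat.Divisibility
open import Data.Fin using (Fin; toℕ; fromℕ<)
open import Data.Fin.Properties using (toℕ-fromℕ<; toℕ-injective; toℕ<n)
open import Data.Fin.Subset using (Subset; ∣_∣; _∈_)
open import Data.Vec using (tabulate)
open import Data.Vec.Properties using (lookup∘tabulate; []=⇒lookup; lookup⇒[]=)
open import Data.Product using (Σ; _×_; _,_)
open import Relation.Binary.PropositionalEquality

open import Defs

count : (ℕ → Bool) → ℕ → ℕ
count f zero = 0
count f (suc n) with f 0
... | true  = suc (count (f ∘ suc) n)
... | false = count (f ∘ suc) n

∣tabulate∣≡count : ∀ f n → ∣ tabulate {n = n} (f ∘ toℕ) ∣ ≡ count f n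
∣tabulate∣≡count f zero = refl
∣tabulate∣≡count f (suc n) with f 0
... | true  = cong suc (∣tabulate∣≡count (f ∘ suc) n)
... | false = ∣tabulate∣≡count (f ∘ suc) n

count-cong : ∀ {f g} n → (∀ {k} → k < n → f k ≡ g k) → count f n ≡ count g n
count-cong zero eq = refl
count-cong {f} {g} (suc n) eq with f 0 | g 0 | eq {0} z<s
... | true  | true  | _ = cong suc (count-cong n (eq ∘ s<s))
... | false | false | _ = count-cong n (eq ∘ s<s)

count-+ : ∀ f m n → count f (m + n) ≡ count f m + count (f ∘ (m +_)) n
count-+ f zero n = refl
count-+ f (suc m) n with f 0
... | true  = cong suc (count-+ (f ∘ suc) m n)
... | false = count-+ (f ∘ suc) m n

count-periodic : ∀ f {p} → (∀ k → f (p + k) ≡ f k) → ∀ q → count f (q * p) ≡ q * count f p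
count-periodic f {p} per zero = refl
count-periodic f {p} per (suc q) = begin
  count f (p + q * p)                  ≡⟨ count-+ f p (q * p) ⟩
  count f p + count (f ∘ (p +_)) (q * p) ≡⟨ cong (count f p +_) (count-cong (q * p) (λ {k} _ → per k)) ⟩
  count f p + count f (q * p)          ≡⟨ cong (count f p +_) (count-periodic f per q) ⟩
  count f p + q * count f p            ∎
  where open ≡-Reasoning

count-<ᵇ : ∀ {D n} → D ≤ n → count (_<ᵇ D) n ≡ D
count-<ᵇ {n = n} z≤n = count-<ᵇ0 n
  where
  count-<ᵇ0 : ∀ n → count (_<ᵇ 0) n ≡ 0
  count-<ᵇ0 zero = refl
  count-<ᵇ0 (suc n) = count-<ᵇ0 n
count-<ᵇ (s≤s D≤n) = cong suc (count-<ᵇ D≤n)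

count-low-residues : ∀ B {D} .{{_ : NonZero B}} → D ≤ B → ∀ q →
                     count (λ k → k % B <ᵇ D) (q * B) ≡ q * D
count-low-residues B {D} D≤B q = begin
  count low (q * B) ≡⟨ count-periodic low periodic q ⟩
  q * count low B   ≡⟨ cong (q *_) (count-cong B (λ k<B → cong (_<ᵇ D) (m<n⇒m%n≡m k<B))) ⟩
  q * count (_<ᵇ D) B ≡⟨ cong (q *_) (count-<ᵇ D≤B) ⟩
  q * D             ∎
  where
  open ≡-Reasoning
  low : ℕ → Bool
  low k = k % B <ᵇ D
  periodic : ∀ k → low (B + k) ≡ low k
  periodic k = cong (λ r → r <ᵇ D) (trans (cong (_% B) (+-comm B k)) ([m+n]%n≡m%n k B))

∈-tabulate⁻ : ∀ {n} {f : Fin n → Bool} {x} → x ∈ tabulate f → T (f x)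
∈-tabulate⁻ {f = f} {x} x∈ = Equivalence.from T-≡ (trans (sym (lookup∘tabulate f x)) ([]=⇒lookup x∈))

∈-tabulate⁺ : ∀ {n} {f : Fin n → Bool} {x} → T (f x) → x ∈ tabulate f
∈-tabulate⁺ {f = f} {x} fx = lookup⇒[]= x (tabulate f) (trans (lookup∘tabulate f x) (Equivalence.to T-≡ fx))

n∣m∧m<n⇒m≡0 : ∀ {D s} .{{_ : NonZero D}} → D ∣ s → s < D → s ≡ 0
n∣m∧m<n⇒m≡0 {D} {s} D∣s s<D = trans (sym (m<n⇒m%n≡m s<D)) (n∣m⇒m%n≡0 s D D∣s)

n∣m∧m<o*n⇒m+n≤o*n : ∀ {D s} d → D ∣ s → s < d * D → s + D ≤ d * D
n∣m∧m<o*n⇒m+n≤o*n {D} d (divides-refl q) qD<dD = begin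
  q * D + D   ≡⟨ +-comm (q * D) D ⟩
  suc q * D   ≤⟨ *-monoˡ-≤ D (*-cancelʳ-< D q d qD<dD) ⟩
  d * D       ∎
  where open ≤-Reasoning

module _ {m : ℕ} .{{_ : NonZero m}} where

  toℕ-mod : ∀ k → toℕ (k mod m) ≡ k % m
  toℕ-mod k = toℕ-fromℕ< (m%n<n k m)

  toℕ-zeroₘ : toℕ (zeroₘ {m}) ≡ 0
  toℕ-zeroₘ = trans (toℕ-mod 0) (m<n⇒m%n≡m (>-nonZero⁻¹ m))

  ⊖-self : (x : Fin m) → x ⊖ x ≡ zeroₘ
  ⊖-self x = toℕ-injective (begin
    toℕ ((toℕ x + m ∸ toℕ x) mod m) ≡⟨ toℕ-mod _ ⟩
    (toℕ x + m ∸ toℕ x) % m         ≡⟨ cong (_% m) (m+n∸m≡n (toℕ x) m) ⟩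
    m % m                           ≡⟨ n%n≡0 m ⟩
    0                               ≡⟨ toℕ-zeroₘ ⟨
    toℕ (zeroₘ {m})                 ∎)
    where open ≡-Reasoning

  ⊖-+-%-∣ : ∀ B .{{_ : NonZero B}} → B ∣ m → (a b : Fin m) →
            (toℕ (a ⊖ b) + toℕ b) % B ≡ toℕ a % B
  ⊖-+-%-∣ B B∣m a b = begin
    (toℕ (a ⊖ b) + toℕ b) % B     ≡⟨ cong (λ t → (t + toℕ b) % B) (toℕ-mod y) ⟩
    (y % m + toℕ b) % B          ≡⟨ %-distribˡ-+ (y % m) (toℕ b) B ⟩
    (y % m % B + toℕ b % B) % B  ≡⟨ cong (λ t → (t + toℕ b % B) % B) (m∣n⇒o%n%m≡o%m B m y B∣m) ⟩
    (y % B + toℕ b % B) % B      ≡⟨ %-distribˡ-+ y (toℕ b) B ⟨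
    (y + toℕ b) % B              ≡⟨ cong (_% B) (m∸n+n≡m (≤-trans (<⇒≤ (toℕ<n b)) (m≤n+m m (toℕ a)))) ⟩
    (toℕ a + m) % B              ≡⟨ %-remove-+ʳ (toℕ a) B∣m ⟩
    toℕ a % B                    ∎
    where
    open ≡-Reasoning
    y = toℕ a + m ∸ toℕ b

lowResidues : ∀ {m} B .{{_ : NonZero B}} → ℕ → Subset m
lowResidues B D = tabulate (λ x → toℕ x % B <ᵇ D)

∣lowResidues∣ : ∀ {m} B D .{{_ : NonZero B}} q → m ≡ q * B → D ≤ B →
                ∣ lowResidues {m} B D ∣ ≡ q * D
∣lowResidues∣ B D q refl D≤B =
  trans (∣tabulate∣≡count (λ k → k % B <ᵇ D) (q * B)) (count-low-residues B D≤B q)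

zeroₘ∈lowResidues : ∀ {m} B D .{{_ : NonZero m}} .{{_ : NonZero B}} .{{_ : NonZero D}} →
                    zeroₘ ∈ lowResidues {m} B D
zeroₘ∈lowResidues {m} B D = ∈-tabulate⁺ (<⇒<ᵇ (begin-strict
  toℕ (zeroₘ {m}) % B ≡⟨ cong (_% B) toℕ-zeroₘ ⟩
  0 % B               ≡⟨ m<n⇒m%n≡m (>-nonZero⁻¹ B) ⟩
  0                   <⟨ >-nonZero⁻¹ D ⟩
  D                   ∎))
  where open ≤-Reasoning

∈Diff-lowResidues-∣ : ∀ {m} d D .{{_ : NonZero m}} .{{_ : NonZero D}} .{{_ : NonZero (d * D)}} →
                      d * D ∣ m → (x : Fin m) → x ∈Diff lowResidues (d * D) D →
                      D ∣ toℕ x → d * D ∣ toℕ x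
∈Diff-lowResidues-∣ {m} d D dD∣m x (a , a' , a∈ , a'∈ , refl) D∣x =
  m%n≡0⇒n∣m (toℕ x) (d * D) s≡0
  where
  s = toℕ x % (d * D)
  r = toℕ a' % (d * D)
  r<D : r < D
  r<D = <ᵇ⇒< r D (∈-tabulate⁻ a'∈)
  D∣s : D ∣ s
  D∣s = %-presˡ-∣ D∣x (n∣m*n d)
  s+r<dD : s + r < d * D
  s+r<dD = <-≤-trans (+-monoʳ-< s r<D) (n∣m∧m<o*n⇒m+n≤o*n d D∣s (m%n<n (toℕ x) (d * D)))
  s+r≡a : s + r ≡ toℕ a % (d * D)
  s+r≡a = begin
    s + r                          ≡⟨ m<n⇒m%n≡m s+r<dD ⟨
    (s + r) % (d * D)              ≡⟨ %-distribˡ-+ (toℕ x) (toℕ a') (d * D) ⟨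
    (toℕ x + toℕ a') % (d * D)     ≡⟨ ⊖-+-%-∣ (d * D) dD∣m a a' ⟩
    toℕ a % (d * D)                ∎
    where open ≡-Reasoning
  s<D : s < D
  s<D = ≤-<-trans (m≤m+n s r) (subst (_< D) (sym s+r≡a) (<ᵇ⇒< _ D (∈-tabulate⁻ a∈)))
  s≡0 : s ≡ 0
  s≡0 = n∣m∧m<n⇒m≡0 D∣s s<D

module Construction (d : ℕ) .{{_ : NonZero d}} (n : ℕ) where

  d^-nonZero : ∀ k → NonZero (d ^ k)
  d^-nonZero k = m^n≢0 d k

  instance
    modulus-nonZero : NonZero (d ^ suc n)
    modulus-nonZero = d^-nonZero (suc n)

  A : Fin (suc n) → Subset (d ^ suc n)
  A j = lowResidues (d ^ suc (toℕ j)) {{d^-nonZero (suc (toℕ j))}} (d ^ toℕ j)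

  d^-split : ∀ {j k} → j ≤ k → d ^ k ≡ d ^ (k ∸ j) * d ^ j
  d^-split {j} {k} j≤k = trans (cong (d ^_) (sym (m∸n+n≡m j≤k))) (^-distribˡ-+-* d (k ∸ j) j)

  d^-∣ : ∀ {j k} → j ≤ k → d ^ j ∣ d ^ k
  d^-∣ {j} {k} j≤k = subst (d ^ j ∣_) (sym (d^-split j≤k)) (n∣m*n (d ^ (k ∸ j)))

  ∣A∣ : ∀ j → ∣ A j ∣ ≡ d ^ n
  ∣A∣ j = trans (∣lowResidues∣ (d ^ suc i) (d ^ i) {{d^-nonZero (suc i)}} (d ^ (n ∸ i))
                                (d^-split (toℕ<n j)) (m≤n*m (d ^ i) d))
                (sym (d^-split (s≤s⁻¹ (toℕ<n j))))
    where i = toℕ j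

  zeroₘ∈A : ∀ j → zeroₘ ∈ A j
  zeroₘ∈A j = zeroₘ∈lowResidues (d ^ suc i) (d ^ i) {{_}} {{d^-nonZero (suc i)}} {{d^-nonZero i}}
    where i = toℕ j

  module _ (x : Fin (d ^ suc n)) (x∈ : ∀ j → x ∈Diff A j) where

    A-step : ∀ (j : Fin (suc n)) {k} → toℕ j ≡ k → d ^ k ∣ toℕ x → d ^ suc k ∣ toℕ x
    A-step j refl = ∈Diff-lowResidues-∣ d (d ^ i) {{_}} {{d^-nonZero i}} {{d^-nonZero (suc i)}}
                                        (d^-∣ (toℕ<n j)) x (x∈ j)
      where i = toℕ j

    d^k∣x : ∀ k → k ≤ suc n → d ^ k ∣ toℕ x
    d^k∣x zero    _   = 1∣ _
    d^k∣x (suc k) k<n = A-step (fromℕ< k<n) (toℕ-fromℕ< k<n) (d^k∣x k (<⇒≤ k<n))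

  A-differenceDisjoint : DifferenceDisjoint A
  A-differenceDisjoint x = only-zero , λ { refl j → zeroₘ , zeroₘ , zeroₘ∈A j , zeroₘ∈A j , sym (⊖-self zeroₘ) }
    where
    only-zero : (∀ j → x ∈Diff A j) → x ≡ zeroₘ
    only-zero x∈ = toℕ-injective (trans (n∣m∧m<n⇒m≡0 (d^k∣x x x∈ (suc n) ≤-refl) (toℕ<n x)) (sym toℕ-zeroₘ))

mainTheorem14 : (n d : ℕ) → n ≥ 1 → (d≥2 : d ≥ 2) →
    let instance _ = m^n≢0 d n {{>-nonZero (≤-trans (n≤1+n 1) d≥2)}} in
    Σ (Fin n → Subset (d ^ n)) λ A →
      (∀ i → ∣ A i ∣ ≡ d ^ (n ∸ 1)) × DifferenceDisjoint A
mainTheorem14 (suc n) d@(suc _) _ _ = A , ∣A∣ , A-differenceDisjoint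
  where open Construction d n
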